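{- Let $V$ be a finite set with $|V|$ even. If $v\in \overline{\mathbf N}(PM(V))\cap \mathrm{problem}(V)$ is an additional generator, then the graph $(V,E(v))$ is not B-factorizable.
   Context: Let $K=\binom{V}{2}$ and let $C$ be the set of partitions $\{A,B\}$ of $V$ with $|A|=|B|=|V|/2$; for $c=\{A,B\}\in C$, $B_c$ is the complete bipartite graph with parts $A,B$. In $\mathbb N^{K\cup C}$ ($\mathbb N$ = nonnegative integers), $v|_K$ is the restriction to $K$-coordinates, $\chi_E$ the indicator vector on $K$ of an edge set $E$, $\chi_K$ the all-ones vector on $K$, and $E(v)=\{e\in K: v(e)=1\}$. For a perfect matching $q$ of $B_c$, $\chi_{q,c}$ has value $1$ on the edges of $q$ and on coordinate $c$, $0$ elsewhere; $PM(V)$ is the set of all such vectors. $\mathbf N(PM(V))$ is the set of nonnegative integer combinations of $PM(V)$, and $\overline{\mathbf N}(PM(V))=\{v\in\mathbb N^{K\cup C}: kv\in\mathbf N(PM(V))\text{ for some integer }k\ge1\}$; it is a pointed monoid, and its Hilbert basis is its unique inclusion-minimal subset $\mathcal H$ such that every element of $\overline{\mathbf N}(PM(V))$ is a nonnegative integer combination of elements of $\mathcal H$. An additional generator is an element of the Hilbert basis of $\overline{\mathbf N}(PM(V))$ that does not belong to $PM(V)$. $\mathrm{problem}(V)=\{v\in\mathbb N^{K\cup C}: v|_K\le\chi_K,\ (V,E(v))\text{ is a regular graph},\ \tfrac{|V|}{2}\sum_{c\in C}v(c)=\sum_{e\in K}v(e)\}$. A regular graph $(V,E)$ is B-factorizable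 if every $v\in\overline{\mathbf N}(PM(V))$ with $v|_K=\chi_E$ satisfies $v\in\mathbf N(PM(V))$. -}

module Defs where

open import Level using (Level) renaming (suc to lsuc; zero to lzero)
open import Data.Nat using (ℕ; zero; suc; _+_; _*_; _≤_; _≟_)
open import Data.Bool using (Bool; true; false; if_then_else_) renaming (_≟_ to _≟ᵇ_)
open import Data.Fin as Fin using (Fin; toℕ)
open import Data.Fin.Subset using (Subset; Side; inside; outside; _∈_; _∉_; ∣_∣)
open import Data.Vec using (Vec; []; _∷_)
open import Data.Vec.Properties using (≡-dec)
open import Data.List using (List; []; _∷_; map; allFin; _++_)
open import Data.Nat.ListAction using (sum)
open import Data.List.Relation.Unary.All using (All)
open import Data.Product using (Σ; _×_; _,_)
open import Data.Sum using (_⊎_; inj₁; inj₂)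
open import Data.Unit using (⊤; tt)
open import Relation.Nullary using (¬_; Dec; yes; no)
open import Relation.Nullary.Decidable using (⌊_⌋)
open import Relation.Binary.PropositionalEquality using (_≡_; _≢_)

-- Convention: V = Fin (m + m), so |V| = m + m is even and |V|/2 = m.

-- K = binom(V,2): unordered pairs {i,j}, represented canonically as i < j.
record Edge (n : ℕ) : Set where
  constructor mkE
  field
    fst snd : Fin n
    .lt : fst Fin.< snd
open Edge public

-- canonical representative of the unordered partition {A, complement A}:
-- the first vertex (if any) lies outside A.
Canon : ∀ {n} → Subset n → Set
Canon [] = ⊤
Canon (s ∷ _) = s ≡ outside

canon? : ∀ {n} (A : Subset n) → Dec (Canon A)
canon? [] = yes tt
canon? (s ∷ _) = s ≟ᵇ outside

-- C: balanced partitions {A,B} of V with |A| = |B| = m  (B = complement of A)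
record Part (m : ℕ) : Set where
  constructor mkP
  field
    set : Subset (m + m)
    .size : ∣ set ∣ ≡ m
    .canon : Canon set
open Part public

Coord : ℕ → Set
Coord m = Edge (m + m) ⊎ Part m

Vecs : ℕ → Set
Vecs m = Coord m → ℕ

EdgeSet : ℕ → Set
EdgeSet n = Edge n → Bool

_∈ₑ_ : ∀ {n} → Fin n → Edge n → Set
x ∈ₑ e = x ≡ fst e ⊎ x ≡ snd e

-- e is an edge of the complete bipartite graph B_c, c = {A, V∖A}
Crosses : ∀ {n} → Subset n → Edge n → Set
Crosses A e = (fst e ∈ A × snd e ∉ A) ⊎ (fst e ∉ A × snd e ∈ A)

IsPerfectMatching : ∀ {m} → Part m → EdgeSet (m + m) → Set
IsPerfectMatching c q =
  (∀ e → q e ≡ true → Crosses (set c) e) ×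
  (∀ x → Σ (Edge _) λ e → q e ≡ true × x ∈ₑ e ×
           (∀ e' → q e' ≡ true → x ∈ₑ e' → e' ≡ e))

ind : Bool → ℕ
ind b = if b then 1 else 0

-- w is χ_{q,c} for some c ∈ C and perfect matching q of B_c, i.e. w ∈ PM(V)
IsPM : ∀ {m} → Vecs m → Set
IsPM {m} w = Σ (Part m) λ c → Σ (EdgeSet (m + m)) λ q →
  IsPerfectMatching c q ×
  (∀ e → w (inj₁ e) ≡ ind (q e)) ×
  (∀ c' → w (inj₂ c') ≡ ind ⌊ ≡-dec _≟ᵇ_ (set c') (set c) ⌋)

Comb : ∀ {m} → (Vecs m → Set) → Vecs m → Set
Comb {m} P w = Σ (List (Vecs m)) λ L → All P L × (∀ x → w x ≡ sum (map (λ g → g x) L))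

NN : ∀ {m} → Vecs m → Set
NN = Comb IsPM

NNbar : ∀ {m} → Vecs m → Set
NNbar w = Σ ℕ λ k → 1 ≤ k × NN (λ x → k * w x)

-- subsets of ℕ^(K ∪ C) as predicates respecting (pointwise) equality of vectors
Ext : ∀ {m} → (Vecs m → Set) → Set
Ext {m} P = ∀ {w w' : Vecs m} → (∀ x → w x ≡ w' x) → P w → P w'

IsHilbertBasis : ∀ {m} → (Vecs m → Set) → Set₁
IsHilbertBasis {m} H =
  Ext H ×
  (∀ w → H w → NNbar w) ×
  (∀ w → NNbar w → Comb H w) ×
  (∀ (H' : Vecs m → Set) → Ext H' → (∀ w → H' w → H w) →
     (∀ w → NNbar w → Comb H' w) → ∀ w → H w → H' w)

AdditionalGenerator : ∀ {m} → Vecs m → Set₁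
AdditionalGenerator {m} v =
  Σ (Vecs m → Set) λ H → IsHilbertBasis H × H v × ¬ IsPM v

-- value of w at the edge {i,j} if i < j, else 0
edgeVal : ∀ {m} → Vecs m → Fin (m + m) → Fin (m + m) → ℕ
edgeVal w i j with i Fin.<? j
... | yes p = w (inj₁ (mkE i j p))
... | no _ = 0

-- value of w at the partition {A, V∖A} if A is a canonical balanced part, else 0
partVal : ∀ {m} → Vecs m → Subset (m + m) → ℕ
partVal {m} w A with ∣ A ∣ ≟ m | canon? A
... | yes p | yes q = w (inj₂ (mkP A p q))
... | _ | _ = 0

allSubsets : ∀ n → List (Subset n)
allSubsets zero = [] ∷ []
allSubsets (suc n) = map (inside ∷_) (allSubsets n) ++ map (outside ∷_) (allSubsets n)

sumK : ∀ {m} → Vecs m → ℕ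
sumK {m} w = sum (map (λ i → sum (map (λ j → edgeVal w i j) (allFin (m + m)))) (allFin (m + m)))

sumC : ∀ {m} → Vecs m → ℕ
sumC {m} w = sum (map (partVal w) (allSubsets (m + m)))

E : ∀ {m} → Vecs m → EdgeSet (m + m)
E w e = ⌊ w (inj₁ e) ≟ 1 ⌋

deg : ∀ {m} → Vecs m → Fin (m + m) → ℕ
deg {m} w x = sum (map (λ j → ind ⌊ edgeVal w x j + edgeVal w j x ≟ 1 ⌋) (allFin (m + m)))

RegularE : ∀ {m} → Vecs m → Set
RegularE {m} w = Σ ℕ λ d → ∀ x → deg w x ≡ d

Problem : ∀ {m} → Vecs m → Set
Problem {m} w =
  (∀ e → w (inj₁ e) ≤ 1) × RegularE w × (m * sumC w ≡ sumK w)

BFactorizable : ∀ m → EdgeSet (m + m) → Set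
BFactorizable m Es = ∀ (w : Vecs m) → NNbar w → (∀ e → w (inj₁ e) ≡ ind (Es e)) → NN w

module Submission where

-- Since v|_K ≤ χ_K we have v|_K = χ_{E(v)}, so B-factorizability of
-- (V, E(v)) would give v ∈ N(PM(V)), i.e. v = p₁ + ... + pₖ with pᵢ ∈ PM(V).
--   * k = 1 contradicts v ∉ PM(V);
--   * k = 0 or k ≥ 2 writes v as a sum of elements of N̄(PM(V)) that are
--     each strictly below v in some coordinate (every χ_{q,c} has a
--     coordinate equal to 1, namely c, so any other summand adds to it).
-- The second case contradicts a general fact about Hilbert bases: an element
-- v of a Hilbert basis H is not such a sum.  Otherwise every summand
-- decomposes over H ∖ {v} (its H-summands are below it, hence differ from
-- v), so v ∈ N(H ∖ {v}); then H ∖ {v} already generates N̄(PM(V)), and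
-- minimality of H forces v ∈ H ∖ {v}.

open import Defs
open import Data.Nat using (ℕ; zero; suc; _+_; _≤_; _<_; _>_; z≤n; s≤s; _≟_)
open import Data.Nat.Properties
  using (module ≤-Reasoning; ≤-trans; ≤-reflexive; ≤-<-trans; <-irrefl; m≤m+n; m≤n+m; m<m+n; m<n+m; +-assoc; +-identityʳ)
open import Data.Bool using () renaming (_≟_ to _≟ᵇ_)
open import Data.Fin as Fin using ()
open import Data.Fin.Properties using (all?)
open import Data.Fin.Subset using (Subset; ∣_∣)
open import Data.Fin.Subset.Properties using (anySubset?)
open import Data.Vec.Properties using (≡-dec)
open import Data.List using (List; []; _∷_; map; _++_)
open import Data.Nat.ListAction using (sum)
open import Data.List.Relation.Unary.All as All using (All; []; _∷_)
open import Data.List.Relation.Unary.All.Properties using (++⁺)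
open import Data.Product using (∃; _×_; _,_; proj₁; proj₂)
open import Data.Sum using (inj₁; inj₂)
open import Data.Empty using (⊥-elim; ⊥-elim-irr)
open import Relation.Nullary using (¬_; Dec; yes; no)
open import Relation.Nullary.Decidable using (⌊_⌋; ¬?; decidable-stable)
open import Relation.Binary.PropositionalEquality using (_≡_; refl; sym; trans; cong; cong₂)

private
  variable
    m : ℕ

_≐_ : Vecs m → Vecs m → Set
u ≐ w = ∀ x → u x ≡ w x

sumAt : List (Vecs m) → Coord m → ℕ
sumAt L x = sum (map (λ g → g x) L)

summand-≤-sum : (L : List (Vecs m)) → All (λ p → ∀ x → p x ≤ sumAt L x) L
summand-≤-sum [] = []
summand-≤-sum (p ∷ L) =
  (λ x → m≤m+n (p x) (sumAt L x))
  ∷ All.map (λ p≤ x → ≤-trans (p≤ x) (m≤n+m (sumAt L x) (p x))) (summand-≤-sum L)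

comb-ext : {P : Vecs m → Set} {u w : Vecs m} → u ≐ w → Comb P u → Comb P w
comb-ext u≐w (L , PL , u≐ΣL) = L , PL , λ x → trans (sym (u≐w x)) (u≐ΣL x)

comb-single : {P : Vecs m → Set} {u : Vecs m} → P u → Comb P u
comb-single {u = u} Pu = u ∷ [] , Pu ∷ [] , λ x → sym (+-identityʳ (u x))

comb-zero : {P : Vecs m → Set} → Comb P (λ _ → 0)
comb-zero = [] , [] , λ _ → refl

comb-+ : {P : Vecs m → Set} {u w : Vecs m} →
         Comb P u → Comb P w → Comb P (λ x → u x + w x)
comb-+ (L , PL , u≐ΣL) (M , PM , w≐ΣM) =
  L ++ M , ++⁺ PL PM , λ x → trans (cong₂ _+_ (u≐ΣL x) (w≐ΣM x)) (sym (sum-++ L M x))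
  where
  sum-++ : ∀ L M x → sumAt (L ++ M) x ≡ sumAt L x + sumAt M x
  sum-++ [] M x = refl
  sum-++ (g ∷ L) M x = trans (cong (g x +_) (sum-++ L M x)) (sym (+-assoc (g x) (sumAt L x) (sumAt M x)))

dec-∀-irrelevant : {A : Set} {P : .A → Set} → Dec A → (∀ .a → Dec (P a)) → Dec (∀ .a → P a)
dec-∀-irrelevant (no ¬a) _ = yes λ a → ⊥-elim-irr (¬a a)
dec-∀-irrelevant (yes a) P? with P? a
... | yes Pa = yes λ _ → Pa
... | no ¬Pa = no λ P∀ → ¬Pa (P∀ a)

dec-∀-subset : {n : ℕ} {P : Subset n → Set} → (∀ A → Dec (P A)) → Dec (∀ A → P A)
dec-∀-subset P? with anySubset? (λ A → ¬? (P? A))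
... | yes (A , ¬PA) = no λ P∀ → ¬PA (P∀ A)
... | no ¬∃ = yes λ A → decidable-stable (P? A) (λ ¬PA → ¬∃ (A , ¬PA))

-- Deciding u ≐ w coordinatewise: over all pairs i < j of vertices and all
-- canonical balanced subsets A, the proofs of i < j etc. being irrelevant.
_≐?_ : (u w : Vecs m) → Dec (u ≐ w)
_≐?_ {m} u w with all? (λ i → all? (λ j → dec-∀-irrelevant (i Fin.<? j) (λ p → agreeOnEdge i j p)))
                | dec-∀-subset (λ A → dec-∀-irrelevant (∣ A ∣ ≟ m) λ s →
                                       dec-∀-irrelevant (canon? A) λ c → agreeOnPart A s c)
  where
  agreeOnEdge : ∀ i j .p → Dec (u (inj₁ (mkE i j p)) ≡ w (inj₁ (mkE i j p)))
  agreeOnEdge i j p = u (inj₁ (mkE i j p)) ≟ w (inj₁ (mkE i j p))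
  agreeOnPart : ∀ A .s .c → Dec (u (inj₂ (mkP A s c)) ≡ w (inj₂ (mkP A s c)))
  agreeOnPart A s c = u (inj₂ (mkP A s c)) ≟ w (inj₂ (mkP A s c))
... | yes onEdges | yes onParts = yes λ { (inj₁ (mkE i j p)) → onEdges i j p
                                        ; (inj₂ (mkP A s c)) → onParts A s c }
... | no ¬onEdges | _ = no λ u≐w → ¬onEdges λ i j p → u≐w (inj₁ (mkE i j p))
... | _ | no ¬onParts = no λ u≐w → ¬onParts λ A s c → u≐w (inj₂ (mkP A s c))

StrictlyBelow : Vecs m → Vecs m → Set
StrictlyBelow p w = ∃ λ x → p x < w x

module HilbertBasisElement {H : Vecs m → Set} (basis : IsHilbertBasis H) {v : Vecs m} (Hv : H v) where

  generates : ∀ w → NNbar w → Comb H w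
  generates = proj₁ (proj₂ (proj₂ basis))

  H⁻ : Vecs m → Set
  H⁻ w = H w × ¬ (w ≐ v)

  H⁻-ext : Ext H⁻
  H⁻-ext w≐w' (Hw , w≉v) = proj₁ basis w≐w' Hw , λ w'≐v → w≉v λ x → trans (w≐w' x) (w'≐v x)

  -- An element of N̄(PM(V)) strictly below v decomposes over H ∖ {v}: its
  -- H-summands lie below it, hence below v somewhere, hence differ from v.
  decompose-below : ∀ p → NNbar p → StrictlyBelow p v → Comb H⁻ p
  decompose-below p p∈N̄ (x₀ , p<v) with generates p p∈N̄
  ... | M , HM , p≐ΣM = M , All.zipWith avoid (HM , summand-≤-sum M) , p≐ΣM
    where
    open ≤-Reasoning
    avoid : ∀ {u} → H u × (∀ x → u x ≤ sumAt M x) → H⁻ u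
    avoid {u} (Hu , u≤ΣM) = Hu , λ u≐v → <-irrefl refl (begin-strict
      v x₀        ≡⟨ sym (u≐v x₀) ⟩
      u x₀        ≤⟨ u≤ΣM x₀ ⟩
      sumAt M x₀  ≡⟨ sym (p≐ΣM x₀) ⟩
      p x₀        <⟨ p<v ⟩
      v x₀        ∎)

  -- If v itself is a combination over H ∖ {v}, then so is every
  -- H-combination: replace each copy of v by that combination.
  substitute : Comb H⁻ v → (M : List (Vecs m)) → All H M → Comb H⁻ (sumAt M)
  substitute v∈NH⁻ [] [] = comb-zero
  substitute v∈NH⁻ (u ∷ M) (Hu ∷ HM) with u ≐? v
  ... | yes u≐v = comb-+ (comb-ext (λ x → sym (u≐v x)) v∈NH⁻) (substitute v∈NH⁻ M HM)
  ... | no u≉v = comb-+ (comb-single (Hu , u≉v)) (substitute v∈NH⁻ M HM)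

  not-redundant : ¬ Comb H⁻ v
  not-redundant v∈NH⁻ = proj₂ (minimal H⁻ H⁻-ext (λ _ → proj₁) H⁻-generates v Hv) (λ _ → refl)
    where
    minimal = proj₂ (proj₂ (proj₂ basis))
    H⁻-generates : ∀ w → NNbar w → Comb H⁻ w
    H⁻-generates w w∈N̄ with generates w w∈N̄
    ... | M , HM , w≐ΣM = comb-ext (λ x → sym (w≐ΣM x)) (substitute v∈NH⁻ M HM)

  irreducible : (L : List (Vecs m)) → All NNbar L → All (λ p → StrictlyBelow p v) L →
                ¬ (v ≐ sumAt L)
  irreducible L L∈N̄ L<v v≐ΣL = not-redundant (comb-ext (λ x → sym (v≐ΣL x)) (decompose L L∈N̄ L<v))
    where
    decompose : (L : List (Vecs m)) → All NNbar L → All (λ p → StrictlyBelow p v) L → Comb H⁻ (sumAt L)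
    decompose [] [] [] = comb-zero
    decompose (p ∷ L) (p∈N̄ ∷ L∈N̄) (p<v ∷ L<v) =
      comb-+ (decompose-below p p∈N̄ p<v) (decompose L L∈N̄ L<v)

Positive : Vecs m → Set
Positive p = ∃ λ x → p x > 0

summands-strictly-below : (a b : Vecs m) (L : List (Vecs m)) → All Positive (a ∷ b ∷ L) →
                          All (λ p → StrictlyBelow p (sumAt (a ∷ b ∷ L))) (a ∷ b ∷ L)
summands-strictly-below a b L ((xa , a>0) ∷ (xb , b>0) ∷ _) =
  (xb , m<m+n (a xb) (≤-trans b>0 (m≤m+n (b xb) (sumAt L xb))))
  ∷ All.map (λ p≤ → xa , ≤-<-trans (p≤ xa) (m<n+m (sumAt (b ∷ L) xa) a>0)) (summand-≤-sum (b ∷ L))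

pm-in-N̄ : {p : Vecs m} → IsPM p → NNbar p
pm-in-N̄ p∈PM = 1 , s≤s z≤n , comb-ext (λ x → sym (+-identityʳ _)) (comb-single p∈PM)

pm-positive : {p : Vecs m} → IsPM p → Positive p
pm-positive (c , _ , _ , _ , p≐ind) = inj₂ c , ≤-reflexive (sym (trans (p≐ind c) (ind-self (set c))))
  where
  ind-self : ∀ {n} (A : Subset n) → ind ⌊ ≡-dec _≟ᵇ_ A A ⌋ ≡ 1
  ind-self A with ≡-dec _≟ᵇ_ A A
  ... | yes _ = refl
  ... | no A≢A = ⊥-elim (A≢A refl)

pm-ext : {p w : Vecs m} → p ≐ w → IsPM p → IsPM w
pm-ext p≐w (c , q , matching , onEdges , onParts) =
  c , q , matching , (λ e → trans (sym (p≐w (inj₁ e))) (onEdges e))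
                   , (λ c' → trans (sym (p≐w (inj₂ c'))) (onParts c'))

edges-indicator : (v : Vecs m) → (∀ e → v (inj₁ e) ≤ 1) → ∀ e → v (inj₁ e) ≡ ind (E v e)
edges-indicator v v≤1 e with v (inj₁ e) | v≤1 e
... | zero | _ = refl
... | suc zero | _ = refl
... | suc (suc _) | s≤s ()

lemma3 : (m : ℕ) (v : Vecs m) → NNbar v → Problem v →
    AdditionalGenerator v → ¬ BFactorizable m (E v)
lemma3 m v v∈N̄ (v≤1 , _ , _) (H , basis , Hv , v∉PM) factorizable
  with factorizable v v∈N̄ (edges-indicator v v≤1)
-- v = 0: the empty sum, vacuously of summands below v.
... | [] , [] , v≐0 = irreducible [] [] [] v≐0
  where open HilbertBasisElement basis Hv
-- v = p ∈ PM(V), which an additional generator is not.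
... | p ∷ [] , p∈PM ∷ [] , v≐p = v∉PM (pm-ext (λ x → trans (sym (+-identityʳ (p x))) (sym (v≐p x))) p∈PM)
-- v = a + b + ΣL: every summand is strictly below v somewhere.
... | a ∷ b ∷ L , L∈PM , v≐ΣL =
  irreducible (a ∷ b ∷ L) (All.map pm-in-N̄ L∈PM) summands-below-v v≐ΣL
  where
  open HilbertBasisElement basis Hv
  summands-below-v : All (λ p → StrictlyBelow p v) (a ∷ b ∷ L)
  summands-below-v = All.map (λ { (x , p<ΣL) → x , ≤-trans p<ΣL (≤-reflexive (sym (v≐ΣL x))) })
                       (summands-strictly-below a b L (All.map pm-positive L∈PM))
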